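{- Let $P$ be a poset. If $\mathcal{C}(P)$ contains a totally ordered pregap $(\mathcal{A},\mathcal{B})$ such that $F_{\mathcal{A}}\cap I_{\mathcal{B}}=\emptyset$, then $P$ does not have CFPP.
   Context: $\mathcal{C}(P)$ is the set of nonempty convex subsets of $P$ ordered by the bi-dominating order ($X\le Y$ iff $X\subseteq\downarrow Y$ and $Y\subseteq\uparrow X$, where $\downarrow,\uparrow$ denote generated initial and final segments). A pair $(\mathcal{A},\mathcal{B})$ of subsets of $\mathcal{C}(P)$ is a pregap if $A\le B$ for all $A\in\mathcal{A}$, $B\in\mathcal{B}$; it is totally ordered if $\mathcal{A}\cup\mathcal{B}$ is a chain in $\mathcal{C}(P)$. $I_{\mathcal{B}}:=\bigcap\{\downarrow B: B\in\mathcal{B}\}$ and $F_{\mathcal{A}}:=\bigcap\{\uparrow A: A\in\mathcal{A}\}$. $P$ has CFPP if every order preserving $f:P\to\mathcal{C}(P)$ has some $x$ with $x\in f(x)$. -}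

module Defs where

open import Level using (Level; _⊔_; suc)
open import Data.Product using (Σ; ∃; _×_; _,_)
open import Data.Sum using (_⊎_)
open import Data.Empty using (⊥)
open import Relation.Unary using (Pred; _∈_; _⊆_)
open import Relation.Binary.Bundles using (Poset)

module ConvexSets {c ℓ₁ ℓ₂ : Level} (P : Poset c ℓ₁ ℓ₂) (ℓ : Level) where
  open Poset P renaming (Carrier to |P|)

  ↓ : Pred |P| ℓ → Pred |P| (c ⊔ ℓ₂ ⊔ ℓ)
  ↓ X x = Σ |P| λ y → y ∈ X × x ≤ y

  ↑ : Pred |P| ℓ → Pred |P| (c ⊔ ℓ₂ ⊔ ℓ)
  ↑ X x = Σ |P| λ y → y ∈ X × y ≤ x

  IsConvex : Pred |P| ℓ → Set (c ⊔ ℓ₂ ⊔ ℓ)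
  IsConvex X = ∀ {x y z} → x ∈ X → z ∈ X → x ≤ y → y ≤ z → y ∈ X

  record Conv : Set (c ⊔ ℓ₂ ⊔ Level.suc ℓ) where
    field
      set      : Pred |P| ℓ
      nonempty : ∃ λ x → x ∈ set
      convex   : IsConvex set
  open Conv public

  _⊑_ : Conv → Conv → Set (c ⊔ ℓ₂ ⊔ ℓ)
  X ⊑ Y = (set X ⊆ ↓ (set Y)) × (set Y ⊆ ↑ (set X))

  IsPregap : ∀ {ℓ'} → Pred Conv ℓ' → Pred Conv ℓ' → Set (c ⊔ ℓ₂ ⊔ Level.suc ℓ ⊔ ℓ')
  IsPregap 𝒜 ℬ = ∀ A B → A ∈ 𝒜 → B ∈ ℬ → A ⊑ B

  _∪ᶜ_ : ∀ {ℓ'} → Pred Conv ℓ' → Pred Conv ℓ' → Pred Conv ℓ'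
  (𝒜 ∪ᶜ ℬ) X = X ∈ 𝒜 ⊎ X ∈ ℬ

  IsChain : ∀ {ℓ'} → Pred Conv ℓ' → Set (c ⊔ ℓ₂ ⊔ Level.suc ℓ ⊔ ℓ')
  IsChain 𝒳 = ∀ X Y → X ∈ 𝒳 → Y ∈ 𝒳 → X ⊑ Y ⊎ Y ⊑ X

  IsTotallyOrderedPregap : ∀ {ℓ'} → Pred Conv ℓ' → Pred Conv ℓ' → Set (c ⊔ ℓ₂ ⊔ Level.suc ℓ ⊔ ℓ')
  IsTotallyOrderedPregap 𝒜 ℬ = IsPregap 𝒜 ℬ × IsChain (𝒜 ∪ᶜ ℬ)

  I[_] : ∀ {ℓ'} → Pred Conv ℓ' → Pred |P| (c ⊔ ℓ₂ ⊔ Level.suc ℓ ⊔ ℓ')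
  I[ ℬ ] x = ∀ B → B ∈ ℬ → x ∈ ↓ (set B)

  F[_] : ∀ {ℓ'} → Pred Conv ℓ' → Pred |P| (c ⊔ ℓ₂ ⊔ Level.suc ℓ ⊔ ℓ')
  F[ 𝒜 ] x = ∀ A → A ∈ 𝒜 → x ∈ ↑ (set A)

  CFPP : Set (c ⊔ ℓ₂ ⊔ Level.suc ℓ)
  CFPP = (f : |P| → Conv) → (∀ {x y} → x ≤ y → f x ⊑ f y) → ∃ λ x → x ∈ set (f x)

-- For x ∈ F_𝒜 let ℬₓ be the members B of ℬ with x ∉ ↓B, otherwise let 𝒜ₓ be the members A
-- of 𝒜 with x ∉ ↑A; the hypothesis F_𝒜 ∩ I_ℬ = ∅ makes the relevant family nonempty.  Send x
-- to the convex hull of ⋃ℬₓ, respectively ⋃𝒜ₓ.  Then x lies outside its image, so the map has no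
-- fixed point.  It is order preserving because ℬₓ grows and 𝒜ₓ shrinks with x, F_𝒜 is a final
-- segment, and ℬₓ (𝒜ₓ) is an initial (final) segment of the chain ℬ (𝒜); across the boundary
-- of F_𝒜 the pregap condition compares the two hulls.
module Submission where

open import Defs
open import Level using (Level; Lift; lift; lower; _⊔_)
open import Function using (_∘_)
open import Data.Product using (_×_; ∃; _,_; proj₁; proj₂)
open import Data.Sum using (inj₁; inj₂)
open import Data.Empty using (⊥; ⊥-elim)
open import Relation.Nullary using (¬_; Dec; yes; no)
open import Relation.Nullary.Decidable using (True; toWitness; fromWitness)
open import Relation.Unary using (Pred; _∈_; _∉_; _⊆_)
open import Relation.Binary.Bundles using (Poset)
open import Axiom.ExcludedMiddle using (ExcludedMiddle)
open import Axiom.DoubleNegationElimination using (em⇒dne)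

module Classical (em : ∀ {a} → ExcludedMiddle a) where

  -- Impredicative resizing: under excluded middle every proposition has a copy in any universe.
  Resize : ∀ {a} b → Set a → Set b
  Resize b Q = Lift b (True (em {P = Q}))

  resize : ∀ {a b} {Q : Set a} → Q → Resize b Q
  resize q = lift (fromWitness q)

  unresize : ∀ {a b} {Q : Set a} → Resize b Q → Q
  unresize r = toWitness (lower r)

  ¬∀⇒∃¬ : ∀ {a p q} {A : Set a} {P : Pred A p} {Q : Pred A q} →
          ¬ (∀ x → x ∈ P → x ∈ Q) → ∃ λ x → x ∈ P × x ∉ Q
  ¬∀⇒∃¬ ¬∀ = em⇒dne em λ ¬∃ → ¬∀ λ x x∈P → em⇒dne em λ x∉Q → ¬∃ (x , x∈P , x∉Q)

module Hulls (em : ∀ {a} → ExcludedMiddle a)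
             {c ℓ₁ ℓ₂ : Level} (P : Poset c ℓ₁ ℓ₂) (ℓ : Level) where
  open Poset P renaming (Carrier to |P|)
  open ConvexSets P ℓ
  open Classical em

  -- ↓ and ↑ of Defs, for subsets of P in an arbitrary universe.
  Lower : ∀ {m} → Pred |P| m → Pred |P| (c ⊔ ℓ₂ ⊔ m)
  Lower X x = ∃ λ y → y ∈ X × x ≤ y

  Upper : ∀ {m} → Pred |P| m → Pred |P| (c ⊔ ℓ₂ ⊔ m)
  Upper X x = ∃ λ y → y ∈ X × y ≤ x

  Between : ∀ {m} → Pred |P| m → Pred |P| (c ⊔ ℓ₂ ⊔ m)
  Between X x = x ∈ Upper X × x ∈ Lower X

  hull : ∀ {m} (X : Pred |P| m) → ∃ (λ x → x ∈ X) → Conv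
  hull X (x₀ , x₀∈X) = record
    { set      = λ x → Resize ℓ (Between X x)
    ; nonempty = x₀ , resize ((x₀ , x₀∈X , refl) , (x₀ , x₀∈X , refl))
    ; convex   = λ x∈ z∈ x≤y y≤z →
        let (a , a∈X , a≤x) , _ = unresize {Q = Between X _} x∈
            _ , (b , b∈X , z≤b) = unresize {Q = Between X _} z∈
        in resize ((a , a∈X , trans a≤x x≤y) , (b , b∈X , trans y≤z z≤b))
    }

  ⊆-hull : ∀ {m} {X : Pred |P| m} (ne : ∃ λ x → x ∈ X) → X ⊆ set (hull X ne)
  ⊆-hull _ x∈X = resize ((_ , x∈X , refl) , (_ , x∈X , refl))

  hull⊆Upper : ∀ {m} {X : Pred |P| m} (ne : ∃ λ x → x ∈ X) → set (hull X ne) ⊆ Upper X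
  hull⊆Upper _ x∈ = proj₁ (unresize x∈)

  hull⊆Lower : ∀ {m} {X : Pred |P| m} (ne : ∃ λ x → x ∈ X) → set (hull X ne) ⊆ Lower X
  hull⊆Lower _ x∈ = proj₂ (unresize x∈)

  hull-mono : ∀ {m n} {X : Pred |P| m} {Y : Pred |P| n} →
              (neX : ∃ λ x → x ∈ X) (neY : ∃ λ y → y ∈ Y) →
              X ⊆ Lower Y → Y ⊆ Upper X → hull X neX ⊑ hull Y neY
  hull-mono neX neY X⊆↓Y Y⊆↑X =
    (λ x∈ → let (a , a∈X , x≤a) = hull⊆Lower neX x∈
                (b , b∈Y , a≤b) = X⊆↓Y a∈X
            in b , ⊆-hull neY b∈Y , trans x≤a a≤b)
    ,
    (λ y∈ → let (b , b∈Y , b≤y) = hull⊆Upper neY y∈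
                (a , a∈X , a≤b) = Y⊆↑X b∈Y
            in a , ⊆-hull neX a∈X , trans a≤b b≤y)

  ⋃ : ∀ {m} → Pred Conv m → Pred |P| (c ⊔ ℓ₂ ⊔ Level.suc ℓ ⊔ m)
  ⋃ 𝒮 x = ∃ λ S → S ∈ 𝒮 × x ∈ set S

  ⋃-nonempty : ∀ {m} {𝒮 : Pred Conv m} → ∃ (λ S → S ∈ 𝒮) → ∃ λ x → x ∈ ⋃ 𝒮
  ⋃-nonempty (S , S∈𝒮) = let (x , x∈S) = nonempty S in x , S , S∈𝒮 , x∈S

  ⋃-mono : ∀ {m n} {𝒮 : Pred Conv m} {𝒯 : Pred Conv n} → 𝒮 ⊆ 𝒯 → ⋃ 𝒮 ⊆ ⋃ 𝒯
  ⋃-mono 𝒮⊆𝒯 (S , S∈𝒮 , x∈S) = S , 𝒮⊆𝒯 S∈𝒮 , x∈S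

  ⊆⇒⊆Lower : ∀ {m} {X : Pred |P| m} → X ⊆ Lower X
  ⊆⇒⊆Lower x∈X = _ , x∈X , refl

  ⊆⇒⊆Upper : ∀ {m} {X : Pred |P| m} → X ⊆ Upper X
  ⊆⇒⊆Upper x∈X = _ , x∈X , refl

  IsInitialIn : ∀ {m n} → Pred Conv m → Pred Conv n → Set _
  IsInitialIn 𝒮 𝒯 = ∀ {S T} → S ∈ 𝒮 → T ∈ 𝒯 → T ⊑ S → T ∈ 𝒮

  IsFinalIn : ∀ {m n} → Pred Conv m → Pred Conv n → Set _
  IsFinalIn 𝒮 𝒯 = ∀ {S T} → S ∈ 𝒮 → T ∈ 𝒯 → S ⊑ T → T ∈ 𝒮

  -- Each T ∈ 𝒯 either lies in the initial segment 𝒮 or is above its member S₀.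
  ⋃-initial-⊆-Upper : ∀ {m n} {𝒮 : Pred Conv m} {𝒯 : Pred Conv n} → IsChain 𝒯 →
                      𝒮 ⊆ 𝒯 → IsInitialIn 𝒮 𝒯 → ∃ (λ S → S ∈ 𝒮) → ⋃ 𝒯 ⊆ Upper (⋃ 𝒮)
  ⋃-initial-⊆-Upper chain 𝒮⊆𝒯 initial (S₀ , S₀∈𝒮) (T , T∈𝒯 , x∈T)
    with chain S₀ T (𝒮⊆𝒯 S₀∈𝒮) T∈𝒯
  ... | inj₁ (_ , T⊆↑S₀) = let (a , a∈S₀ , a≤x) = T⊆↑S₀ x∈T in a , (S₀ , S₀∈𝒮 , a∈S₀) , a≤x
  ... | inj₂ T⊑S₀        = ⊆⇒⊆Upper (T , initial S₀∈𝒮 T∈𝒯 T⊑S₀ , x∈T)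

  ⋃-final-⊆-Lower : ∀ {m n} {𝒮 : Pred Conv m} {𝒯 : Pred Conv n} → IsChain 𝒯 →
                    𝒮 ⊆ 𝒯 → IsFinalIn 𝒮 𝒯 → ∃ (λ S → S ∈ 𝒮) → ⋃ 𝒯 ⊆ Lower (⋃ 𝒮)
  ⋃-final-⊆-Lower chain 𝒮⊆𝒯 final (S₀ , S₀∈𝒮) (T , T∈𝒯 , x∈T)
    with chain S₀ T (𝒮⊆𝒯 S₀∈𝒮) T∈𝒯
  ... | inj₁ S₀⊑T        = ⊆⇒⊆Lower (T , final S₀∈𝒮 T∈𝒯 S₀⊑T , x∈T)
  ... | inj₂ (T⊆↓S₀ , _) = let (b , b∈S₀ , x≤b) = T⊆↓S₀ x∈T in b , (S₀ , S₀∈𝒮 , b∈S₀) , x≤b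

  module _ {m n} {𝒜 ℬ : Pred Conv m} {𝒮 𝒯 : Pred Conv n}
           (pregap : IsPregap 𝒜 ℬ) (𝒮⊆𝒜 : 𝒮 ⊆ 𝒜) (𝒯⊆ℬ : 𝒯 ⊆ ℬ) where

    ⋃-pregap-⊆-Lower : ∃ (λ T → T ∈ 𝒯) → ⋃ 𝒮 ⊆ Lower (⋃ 𝒯)
    ⋃-pregap-⊆-Lower (T , T∈𝒯) (S , S∈𝒮 , x∈S) =
      let (b , b∈T , x≤b) = proj₁ (pregap S T (𝒮⊆𝒜 S∈𝒮) (𝒯⊆ℬ T∈𝒯)) x∈S
      in b , (T , T∈𝒯 , b∈T) , x≤b

    ⋃-pregap-⊆-Upper : ∃ (λ S → S ∈ 𝒮) → ⋃ 𝒯 ⊆ Upper (⋃ 𝒮)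
    ⋃-pregap-⊆-Upper (S , S∈𝒮) (T , T∈𝒯 , x∈T) =
      let (a , a∈S , a≤x) = proj₂ (pregap S T (𝒮⊆𝒜 S∈𝒮) (𝒯⊆ℬ T∈𝒯)) x∈T
      in a , (S , S∈𝒮 , a∈S) , a≤x

module Construction (em : ∀ {a} → ExcludedMiddle a)
                    {c ℓ₁ ℓ₂ : Level} (P : Poset c ℓ₁ ℓ₂) (ℓ : Level)
                    {ℓ' : Level} (𝒜 ℬ : Pred (ConvexSets.Conv P ℓ) ℓ') where
  open Poset P renaming (Carrier to |P|)
  open ConvexSets P ℓ
  open Classical em
  open Hulls em P ℓ

  𝒜[_] : |P| → Pred Conv (c ⊔ ℓ₂ ⊔ ℓ ⊔ ℓ')
  𝒜[ x ] A = A ∈ 𝒜 × x ∉ ↑ (set A)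

  ℬ[_] : |P| → Pred Conv (c ⊔ ℓ₂ ⊔ ℓ ⊔ ℓ')
  ℬ[ x ] B = B ∈ ℬ × x ∉ ↓ (set B)

  𝒜[]-nonempty : ∀ {x} → x ∉ F[ 𝒜 ] → ∃ λ A → A ∈ 𝒜[ x ]
  𝒜[]-nonempty x∉F = ¬∀⇒∃¬ x∉F

  𝒜[]-antitone : ∀ {x y} → x ≤ y → 𝒜[ y ] ⊆ 𝒜[ x ]
  𝒜[]-antitone x≤y (A∈𝒜 , y∉↑A) = A∈𝒜 , λ (a , a∈A , a≤x) → y∉↑A (a , a∈A , trans a≤x x≤y)

  ℬ[]-monotone : ∀ {x y} → x ≤ y → ℬ[ x ] ⊆ ℬ[ y ]
  ℬ[]-monotone x≤y (B∈ℬ , x∉↓B) = B∈ℬ , λ (b , b∈B , y≤b) → x∉↓B (b , b∈B , trans x≤y y≤b)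

  𝒜[]-final : ∀ {x} → IsFinalIn 𝒜[ x ] 𝒜
  𝒜[]-final (_ , x∉↑S) T∈𝒜 (_ , T⊆↑S) =
    T∈𝒜 , λ (t , t∈T , t≤x) → let (s , s∈S , s≤t) = T⊆↑S t∈T in x∉↑S (s , s∈S , trans s≤t t≤x)

  ℬ[]-initial : ∀ {x} → IsInitialIn ℬ[ x ] ℬ
  ℬ[]-initial (_ , x∉↓S) T∈ℬ (T⊆↓S , _) =
    T∈ℬ , λ (t , t∈T , x≤t) → let (s , s∈S , t≤s) = T⊆↓S t∈T in x∉↓S (s , s∈S , trans x≤t t≤s)

  F-final : ∀ {x y} → x ≤ y → x ∈ F[ 𝒜 ] → y ∈ F[ 𝒜 ]
  F-final x≤y x∈F A A∈𝒜 = let (a , a∈A , a≤x) = x∈F A A∈𝒜 in a , a∈A , trans a≤x x≤y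

  module NoFixedPoint (tot : IsTotallyOrderedPregap 𝒜 ℬ)
                      (disjoint : ∀ x → x ∈ F[ 𝒜 ] → x ∈ I[ ℬ ] → ⊥) where
    pregap : IsPregap 𝒜 ℬ
    pregap = proj₁ tot

    𝒜-chain : IsChain 𝒜
    𝒜-chain A A' A∈𝒜 A'∈𝒜 = proj₂ tot A A' (inj₁ A∈𝒜) (inj₁ A'∈𝒜)

    ℬ-chain : IsChain ℬ
    ℬ-chain B B' B∈ℬ B'∈ℬ = proj₂ tot B B' (inj₂ B∈ℬ) (inj₂ B'∈ℬ)

    ℬ[]-nonempty : ∀ {x} → x ∈ F[ 𝒜 ] → ∃ λ B → B ∈ ℬ[ x ]
    ℬ[]-nonempty {x} x∈F = ¬∀⇒∃¬ (disjoint x x∈F)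

    ⋃ℬ[]-nonempty : ∀ {x} → x ∈ F[ 𝒜 ] → ∃ λ b → b ∈ ⋃ ℬ[ x ]
    ⋃ℬ[]-nonempty x∈F = ⋃-nonempty (ℬ[]-nonempty x∈F)

    ⋃𝒜[]-nonempty : ∀ {x} → x ∉ F[ 𝒜 ] → ∃ λ a → a ∈ ⋃ 𝒜[ x ]
    ⋃𝒜[]-nonempty x∉F = ⋃-nonempty (𝒜[]-nonempty x∉F)

    hullMap : ∀ x → Dec (x ∈ F[ 𝒜 ]) → Conv
    hullMap x (yes x∈F) = hull (⋃ ℬ[ x ]) (⋃ℬ[]-nonempty x∈F)
    hullMap x (no x∉F)  = hull (⋃ 𝒜[ x ]) (⋃𝒜[]-nonempty x∉F)

    hullMap-monotone : ∀ {x y} (x∈F? : Dec (x ∈ F[ 𝒜 ])) (y∈F? : Dec (y ∈ F[ 𝒜 ])) →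
                 x ≤ y → hullMap x x∈F? ⊑ hullMap y y∈F?
    hullMap-monotone (yes x∈F) (yes y∈F) x≤y =
      hull-mono (⋃ℬ[]-nonempty x∈F) (⋃ℬ[]-nonempty y∈F)
        (⊆⇒⊆Lower ∘ ⋃-mono (ℬ[]-monotone x≤y))
        (⋃-initial-⊆-Upper ℬ-chain proj₁ ℬ[]-initial (ℬ[]-nonempty x∈F) ∘ ⋃-mono proj₁)
    hullMap-monotone (no x∉F) (no y∉F) x≤y =
      hull-mono (⋃𝒜[]-nonempty x∉F) (⋃𝒜[]-nonempty y∉F)
        (⋃-final-⊆-Lower 𝒜-chain proj₁ 𝒜[]-final (𝒜[]-nonempty y∉F) ∘ ⋃-mono proj₁)
        (⊆⇒⊆Upper ∘ ⋃-mono (𝒜[]-antitone x≤y))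
    hullMap-monotone (no x∉F) (yes y∈F) x≤y =
      hull-mono (⋃𝒜[]-nonempty x∉F) (⋃ℬ[]-nonempty y∈F)
        (⋃-pregap-⊆-Lower pregap proj₁ proj₁ (ℬ[]-nonempty y∈F))
        (⋃-pregap-⊆-Upper pregap proj₁ proj₁ (𝒜[]-nonempty x∉F))
    hullMap-monotone (yes x∈F) (no y∉F) x≤y = ⊥-elim (y∉F (F-final x≤y x∈F))

    hullMap-fixpoint-free : ∀ x (x∈F? : Dec (x ∈ F[ 𝒜 ])) → x ∉ set (hullMap x x∈F?)
    hullMap-fixpoint-free x (yes x∈F) x∈hull =
      let (b , (B , (_ , x∉↓B) , b∈B) , x≤b) = hull⊆Lower (⋃ℬ[]-nonempty x∈F) x∈hull
      in x∉↓B (b , b∈B , x≤b)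
    hullMap-fixpoint-free x (no x∉F) x∈hull =
      let (a , (A , (_ , x∉↑A) , a∈A) , a≤x) = hull⊆Upper (⋃𝒜[]-nonempty x∉F) x∈hull
      in x∉↑A (a , a∈A , a≤x)

    f : |P| → Conv
    f x = hullMap x em

    f-monotone : ∀ {x y} → x ≤ y → f x ⊑ f y
    f-monotone = hullMap-monotone em em

    f-fixpoint-free : ∀ {x} → x ∉ set (f x)
    f-fixpoint-free {x} = hullMap-fixpoint-free x em

mainTheorem20 : (em : ∀ {a} → ExcludedMiddle a) →
    ∀ {c ℓ₁ ℓ₂ : Level} (P : Poset c ℓ₁ ℓ₂) (ℓ ℓ' : Level) →
    let open ConvexSets P ℓ in
    (𝒜 ℬ : Pred Conv ℓ') →
    IsTotallyOrderedPregap 𝒜 ℬ →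
    (∀ x → x ∈ F[ 𝒜 ] → x ∈ I[ ℬ ] → ⊥) →
    ¬ CFPP
mainTheorem20 em P ℓ ℓ' 𝒜 ℬ tot disjoint cfpp =
  let (x , x∈fx) = cfpp f f-monotone in f-fixpoint-free x∈fx
  where open Construction.NoFixedPoint em P ℓ 𝒜 ℬ tot disjoint
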